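{- The Calculus of Constructions encodes the intensional-level ($\mathbf{iMF}$) constructors of inductive predicates and of coinductive predicates. That is, reading $\mathbf{iMF}$ in the Calculus of Constructions in the standard way (propositions and small propositions as inhabitants of the impredicative sort $\mathsf{Prop}$, the universe $\mathsf{Prop_s}$ as $\mathsf{Prop}$), for every set $A$, family $I(x)\ [x\in A]$ and $C(x,y)\in A\to\mathsf{Prop}\ [x\in A,y\in I(x)]$ there are interpretations of $\mathsf{Ind}_{I,C}$, $\mathsf{ind}$, $\mathsf{El_{Ind}}$, $\mathsf{CoInd}_{I,C}$, $\mathsf{des}$, $\mathsf{coind}$ in the Calculus of Constructions validating all the rules listed below (including the computation rule $\mathsf{C}\text{ - }\mathsf{Ind}$): $\mathsf{F}\text{ - }\mathsf{Ind}$: for $a\in A$, $\mathsf{Ind}_{I,C}(a)\ \mathsf{prop_s}$; $\mathsf{I}\text{ - }\mathsf{Ind}$: for $a\in A$, $i\in I(a)$, $p\in(\forall x\,\varepsilon\,C(a,i))\mathsf{Ind}_{I,C}(x)$, $\mathsf{ind}(a,i,p)\in\mathsf{Ind}_{I,C}(a)$; $\mathsf{E}\text{ - }\mathsf{Ind}$: for $P(x)\ \mathsf{prop}\ [x\in A]$, $c(x,y,w)\in P(x)\ [x\in A,y\in I(x),w\in(\forall z\,\varepsilon\,C(x,y))P(z)]$, $a\in A$, $p\in\mathsf{Ind}_{I,C}(a)$: $\mathsf{El_{Ind}}(a,p,(x,y,w).c)\in P(a)$; $\mathsf{C}\text{ - }\mathsf{Ind}$: with the premises of $\mathsf{E}\text{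 - }\mathsf{Ind}$ for $P,c$, and $a\in A$, $i\in I(a)$, $p\in(\forall x\,\varepsilon\,C(a,i))\mathsf{Ind}_{I,C}(x)$: $\mathsf{El_{Ind}}(a,\mathsf{ind}(a,i,p),(x,y,w).c)=c(a,i,\lambda z.\lambda q.\mathsf{El_{Ind}}(z,p(z,q),(x,y,w).c))\in P(a)$; $\mathsf{F}\text{ - }\mathsf{CoInd}$: for $a\in A$, $\mathsf{CoInd}_{I,C}(a)\ \mathsf{prop_s}$; $\mathsf{E}\text{ - }\mathsf{CoInd}$: for $a\in A$, $i\in I(a)$, $p\in\mathsf{CoInd}_{I,C}(a)$: $\mathsf{des}(a,i,p)\in(\exists x\,\varepsilon\,C(a,i))\mathsf{CoInd}_{I,C}(x)$; $\mathsf{I}\text{ - }\mathsf{CoInd}$: for $P(x)\ \mathsf{prop}\ [x\in A]$, $c(x,y,w)\in(\exists z\,\varepsilon\,C(x,y))P(z)\ [x\in A,y\in I(x),w\in P(x)]$, $a\in A$, $p\in P(a)$: $\mathsf{coind}(a,p,(x,y,w).c)\in\mathsf{CoInd}_{I,C}(a)$.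
   Context: The intensional level $\mathbf{iMF}$ of the Minimalist Foundation is a dependent type theory à la Martin-Löf with four kinds of types (small propositions, propositions, sets, collections), proof-relevant propositions of intuitionistic predicate logic with intensional equality, only $\beta$-equalities as computation rules, eliminations of logical constructors acting only toward propositions, and a universe à la Russell $\mathsf{Prop_s}$ of small propositions. Subsets of a set $A$ are represented by propositional functions $V\in A\to\mathsf{Prop_s}$, with $x\,\varepsilon\,V:\equiv V(x)$, $(\forall x\,\varepsilon\,V)\varphi(x):\equiv(\forall x\in A)(x\,\varepsilon\,V\Rightarrow\varphi(x))$, $(\exists x\,\varepsilon\,V)\varphi(x):\equiv(\exists x\in A)(x\,\varepsilon\,V\wedge\varphi(x))$. A theory $\mathcal{T}$ encodes a type constructor (a set of rules in the language of $\mathcal{T}$) if each new symbol of the constructor can be interpreted in $\mathcal{T}$ so that all its rules are valid under the interpretation. -}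

module Defs where

open import Relation.Binary.PropositionalEquality using (_≡_)

-- A (shallow) model of the Calculus of Constructions' impredicative sort Prop:
-- a sort Prp of propositions (itself a type), proofs Prf φ, and dependent
-- products Π over ARBITRARY types X (impredicativity: X may be Prp, A → Prp,
-- Prf φ, ...), with λ-abstraction, application and β-conversion.
-- Sets of iMF are read as types (Set), propositions and small propositions
-- as inhabitants of Prp, and the universe Prop_s as Prp itself.
record CoC : Set₁ where
  field
    Prp : Set
    Prf : Prp → Set
    Π   : (X : Set) → (X → Prp) → Prp
    lam : {X : Set} {B : X → Prp} → ((x : X) → Prf (B x)) → Prf (Π X B)
    app : {X : Set} {B : X → Prp} → Prf (Π X B) → (x : X) → Prf (B x)
    β   : {X : Set} {B : X → Prp} (f : (x : X) → Prf (B x)) (x : X) →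
          app {X} {B} (lam f) x ≡ f x

module Logic (M : CoC) where
  open CoC M

  infixr 5 _⇒_
  _⇒_ : Prp → Prp → Prp
  φ ⇒ ψ = Π (Prf φ) (λ _ → ψ)

  infixr 6 _∧_
  _∧_ : Prp → Prp → Prp
  φ ∧ ψ = Π Prp (λ R → (φ ⇒ ψ ⇒ R) ⇒ R)

  ∀' : (X : Set) → (X → Prp) → Prp
  ∀' = Π

  ∃' : (X : Set) → (X → Prp) → Prp
  ∃' X φ = Π Prp (λ R → ∀' X (λ x → φ x ⇒ R) ⇒ R)

  ∀ε : {A : Set} → (A → Prp) → (A → Prp) → Prp
  ∀ε {A} V φ = ∀' A (λ x → V x ⇒ φ x)

  ∃ε : {A : Set} → (A → Prp) → (A → Prp) → Prp
  ∃ε {A} V φ = ∃' A (λ x → V x ∧ φ x)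

record IndCoIndInterp (M : CoC) (A : Set) (I : A → Set)
                      (C : (x : A) → I x → A → CoC.Prp M) : Set₁ where
  open CoC M
  open Logic M
  field
    Ind   : A → Prp
    ind   : (a : A) (i : I a) → Prf (∀ε (C a i) Ind) → Prf (Ind a)
    ElInd : (P : A → Prp) →
            (c : (x : A) (y : I x) → Prf (∀ε (C x y) P) → Prf (P x)) →
            (a : A) → Prf (Ind a) → Prf (P a)
    C-Ind : (P : A → Prp) →
            (c : (x : A) (y : I x) → Prf (∀ε (C x y) P) → Prf (P x)) →
            (a : A) (i : I a) (p : Prf (∀ε (C a i) Ind)) →
            ElInd P c a (ind a i p)
              ≡ c a i (lam (λ z → lam (λ q → ElInd P c z (app (app p z) q))))
    CoInd : A → Prp
    des   : (a : A) (i : I a) → Prf (CoInd a) → Prf (∃ε (C a i) CoInd)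
    coind : (P : A → Prp) →
            (c : (x : A) (y : I x) → Prf (P x) → Prf (∃ε (C x y) P)) →
            (a : A) → Prf (P a) → Prf (CoInd a)

{-# OPTIONS --safe #-}

-- Ind is the impredicative least predicate closed under the rules
-- "x holds if every z ε C(x,y) does" (y ∈ I(x)): Ind(a) says that a satisfies
-- every closed predicate, and El_Ind instantiates this at P.  C-Ind then holds
-- by β-conversion alone, since ind(a,i,p) applied to a closed predicate is one
-- application of the rule (a,i).  Dually, CoInd is the union of all consistent
-- predicates P (those with P x ⇒ (∃z ε C(x,y)) P z): coind packs P with its
-- consistency proof, and des unpacks such a witness and repacks it at z.
module Submission where

open import Defs
open import Relation.Binary.PropositionalEquality using (_≡_; cong; trans; module ≡-Reasoning)

module NaturalDeduction (M : CoC) where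
  open CoC M
  open Logic M

  private
    variable
      X : Set
      φ ψ R : Prp

  ⇒-intro : (Prf φ → Prf ψ) → Prf (φ ⇒ ψ)
  ⇒-intro = lam

  ⇒-elim : Prf (φ ⇒ ψ) → Prf φ → Prf ψ
  ⇒-elim = app

  ∧-intro : Prf φ → Prf ψ → Prf (φ ∧ ψ)
  ∧-intro a b = lam λ R → ⇒-intro λ k → ⇒-elim (⇒-elim k a) b

  ∧-elim : Prf (φ ∧ ψ) → (Prf φ → Prf ψ → Prf R) → Prf R
  ∧-elim {R = R} p k = ⇒-elim (app p R) (⇒-intro λ a → ⇒-intro λ b → k a b)

  ∃-intro : {B : X → Prp} (x : X) → Prf (B x) → Prf (∃' X B)
  ∃-intro x b = lam λ R → ⇒-intro λ k → ⇒-elim (app k x) b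

  ∃-elim : {B : X → Prp} → Prf (∃' X B) → ((x : X) → Prf (B x) → Prf R) → Prf R
  ∃-elim {R = R} e k = ⇒-elim (app e R) (lam λ x → ⇒-intro (k x))

  module _ {A : Set} {V B : A → Prp} where

    ∀ε-intro : ((x : A) → Prf (V x) → Prf (B x)) → Prf (∀ε V B)
    ∀ε-intro f = lam λ x → ⇒-intro (f x)

    ∀ε-elim : Prf (∀ε V B) → (x : A) → Prf (V x) → Prf (B x)
    ∀ε-elim f x = ⇒-elim (app f x)

    ∃ε-intro : (x : A) → Prf (V x) → Prf (B x) → Prf (∃ε V B)
    ∃ε-intro x v b = ∃-intro x (∧-intro v b)

    ∃ε-elim : Prf (∃ε V B) → ((x : A) → Prf (V x) → Prf (B x) → Prf R) → Prf R
    ∃ε-elim e k = ∃-elim e λ x vb → ∧-elim vb (k x)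

module Encoding (M : CoC) (A : Set) (I : A → Set)
    (C : (x : A) → I x → A → CoC.Prp M) where
  open CoC M
  open Logic M
  open NaturalDeduction M

  ClosedUnder : (A → Prp) → (x : A) → I x → Prp
  ClosedUnder P x y = ∀ε (C x y) P ⇒ P x

  Closed : (A → Prp) → Prp
  Closed P = ∀' A λ x → ∀' (I x) (ClosedUnder P x)

  Consistent : (A → Prp) → Prp
  Consistent P = ∀' A λ x → ∀' (I x) λ y → P x ⇒ ∃ε (C x y) P

  module _ {P : A → Prp} where

    closed-intro : ((x : A) (y : I x) → Prf (∀ε (C x y) P) → Prf (P x)) →
                   Prf (Closed P)
    closed-intro c = lam λ x → lam λ y → ⇒-intro (c x y)

    closed-elim : Prf (Closed P) → (x : A) (y : I x) → Prf (∀ε (C x y) P) → Prf (P x)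
    closed-elim h x y = ⇒-elim (app (app h x) y)

    closed-β : (c : (x : A) (y : I x) → Prf (∀ε (C x y) P) → Prf (P x))
               (x : A) (y : I x) (w : Prf (∀ε (C x y) P)) →
               closed-elim (closed-intro c) x y w ≡ c x y w
    closed-β c x y w = begin
      ⇒-elim (app (app (closed-intro c) x) y) w
        ≡⟨ cong (λ t → ⇒-elim (app {B = ClosedUnder P x} t y) w) (β _ x) ⟩
      ⇒-elim (app (lam λ y′ → ⇒-intro (c x y′)) y) w
        ≡⟨ cong (λ (t : Prf (ClosedUnder P x y)) → ⇒-elim t w) (β _ y) ⟩
      ⇒-elim (⇒-intro (c x y)) w
        ≡⟨ β _ w ⟩
      c x y w
        ∎
      where open ≡-Reasoning

    consistent-intro : ((x : A) (y : I x) → Prf (P x) → Prf (∃ε (C x y) P)) →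
                       Prf (Consistent P)
    consistent-intro c = lam λ x → lam λ y → ⇒-intro (c x y)

    consistent-elim : Prf (Consistent P) → (x : A) (y : I x) → Prf (P x) →
                      Prf (∃ε (C x y) P)
    consistent-elim h x y = ⇒-elim (app (app h x) y)

  Ind : A → Prp
  Ind a = Π (A → Prp) λ P → Closed P ⇒ P a

  Ind-elim : {P : A → Prp} {a : A} → Prf (Ind a) → Prf (Closed P) → Prf (P a)
  Ind-elim {P} p = ⇒-elim (app p P)

  ind : (a : A) (i : I a) → Prf (∀ε (C a i) Ind) → Prf (Ind a)
  ind a i p = lam λ P → ⇒-intro λ h →
    closed-elim h a i (∀ε-intro λ z q → Ind-elim (∀ε-elim p z q) h)

  Ind-elim-ind : {P : A → Prp} (a : A) (i : I a) (p : Prf (∀ε (C a i) Ind))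
                 (h : Prf (Closed P)) →
                 Ind-elim (ind a i p) h
                   ≡ closed-elim h a i (∀ε-intro λ z q → Ind-elim (∀ε-elim p z q) h)
  Ind-elim-ind {P} a i p h = trans (cong (λ t → app t h) (β _ P)) (β _ h)

  ElInd : (P : A → Prp) →
          (c : (x : A) (y : I x) → Prf (∀ε (C x y) P) → Prf (P x)) →
          (a : A) → Prf (Ind a) → Prf (P a)
  ElInd P c a p = Ind-elim p (closed-intro c)

  C-Ind : (P : A → Prp) →
          (c : (x : A) (y : I x) → Prf (∀ε (C x y) P) → Prf (P x)) →
          (a : A) (i : I a) (p : Prf (∀ε (C a i) Ind)) →
          ElInd P c a (ind a i p)
            ≡ c a i (lam (λ z → lam (λ q → ElInd P c z (app (app p z) q))))
  C-Ind P c a i p = trans (Ind-elim-ind a i p (closed-intro c)) (closed-β c a i _)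

  CoInd : A → Prp
  CoInd a = ∃' (A → Prp) λ P → Consistent P ∧ P a

  CoInd-intro : {P : A → Prp} → Prf (Consistent P) → (a : A) → Prf (P a) →
                Prf (CoInd a)
  CoInd-intro {P} h a pa = ∃-intro P (∧-intro h pa)

  des : (a : A) (i : I a) → Prf (CoInd a) → Prf (∃ε (C a i) CoInd)
  des a i p =
    ∃-elim p λ P hpa → ∧-elim hpa λ h pa →
    ∃ε-elim (consistent-elim h a i pa) λ z cz pz →
    ∃ε-intro z cz (CoInd-intro h z pz)

  coind : (P : A → Prp) →
          (c : (x : A) (y : I x) → Prf (P x) → Prf (∃ε (C x y) P)) →
          (a : A) → Prf (P a) → Prf (CoInd a)
  coind P c = CoInd-intro (consistent-intro c)

  interpretation : IndCoIndInterp M A I C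
  interpretation = record
    { Ind = Ind ; ind = ind ; ElInd = ElInd ; C-Ind = C-Ind
    ; CoInd = CoInd ; des = des ; coind = coind }

proposition3p1 : (M : CoC) (A : Set) (I : A → Set)
    (C : (x : A) → I x → A → CoC.Prp M) → IndCoIndInterp M A I C
proposition3p1 M A I C = Encoding.interpretation M A I C
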